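{- Fix $n\ge1$ and let $w\in\mathcal W_n$. Then $\mathrm{NInc}(w)$ and $\mathrm{Low}(w)$ are nonincreasing words of the same length belonging to $\mathcal W_n$. Let $u$ (resp. $v$) be the positive sequence of $\mathcal P_n$ with $W(u)=\mathrm{NInc}(w)$ (resp. $W(v)=\mathrm{Low}(w)$). Then $u_1=v_1=|w|$ and $u\trianglelefteq v$ in $\mathcal P_n$; set $\Phi_n(w)=[u,v]$. The restriction of $\Phi_n$ to the words of $\mathcal W_n$ avoiding the patterns $aba$ and $acb$ is a bijection between these words and the intervals $[u,v]$ of $\mathcal P_n$ formed by positive sequences with $u_1=v_1$.
   Context: The Nadeau–Tewari poset $\mathcal P_n$ is the set of nonincreasing integer sequences $(u_1,\dots,u_n)$ with $u\trianglelefteq v$ iff $u_i\le v_i$ for all $i$ and, for every $i$, $v_i>v_{i+1}$ implies $u_i>u_{i+1}$. A sequence is positive if all its terms are positive. $\mathcal W_n$ is the set of words on $\{1,\dots,n\}$ containing at least one letter $1$. For a positive sequence $u\in\mathcal P_n$, its vertical encoding $W(u)$ is the nonincreasing word containing, for $1\le i\le n$, exactly $u_i-u_{i+1}$ occurrences of the letter $n+1-i$, where $u_{n+1}:=0$; it has length $u_1$, and $u\mapsto W(u)$ is a bijection from positive sequences of $\mathcal P_n$ to nonincreasing words of $\mathcal W_n$. For a word $w$, $\mathrm{NInc}(w)$ is its rearrangement in nonincreasing order, and $\mathrm{Low}(w)$ is the word with $\mathrm{Low}(w)_i=\min(w_1,\dots,w_i)$. A word avoids $aba$ and $acb$ if there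 are no indices $i<j<k$ with $w_i=w_k<w_j$ or $w_i<w_k<w_j$. $|w|$ is the length of $w$. -}

module Defs where

open import Data.Nat using (ℕ; zero; suc; _≤_; _<_; _∸_; _⊓_; _≤?_)
open import Data.Nat.Properties using ()
open import Data.List using (List; []; _∷_; _++_; length; replicate; lookup)
open import Data.List.Relation.Unary.All using (All)
open import Data.List.Membership.Propositional using (_∈_)
open import Data.Vec using (Vec; []; _∷_; toList)
import Data.Fin as Fin
open import Data.Fin using (Fin)
open import Data.Product using (_×_)
open import Data.Unit using (⊤)
open import Relation.Nullary using (¬_; yes; no)
open import Relation.Binary.PropositionalEquality using (_≡_)

Letter : ℕ → ℕ → Set
Letter n a = 1 ≤ a × a ≤ n

InW : ℕ → List ℕ → Set
InW n w = All (Letter n) w × 1 ∈ w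

data NonIncr : List ℕ → Set where
  ni-[]  : NonIncr []
  ni-[x] : ∀ {x} → NonIncr (x ∷ [])
  ni-∷   : ∀ {x y ys} → y ≤ x → NonIncr (y ∷ ys) → NonIncr (x ∷ y ∷ ys)

insertDesc : ℕ → List ℕ → List ℕ
insertDesc x [] = x ∷ []
insertDesc x (y ∷ ys) with y ≤? x
... | yes _ = x ∷ y ∷ ys
... | no  _ = y ∷ insertDesc x ys

NInc : List ℕ → List ℕ
NInc [] = []
NInc (x ∷ xs) = insertDesc x (NInc xs)

lowFrom : ℕ → List ℕ → List ℕ
lowFrom m [] = []
lowFrom m (x ∷ xs) = (m ⊓ x) ∷ lowFrom (m ⊓ x) xs

Low : List ℕ → List ℕ
Low [] = []
Low (x ∷ xs) = x ∷ lowFrom x xs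

Avoids-aba-acb : List ℕ → Set
Avoids-aba-acb w =
  (i j k : Fin (length w)) → i Fin.< j → j Fin.< k →
    ¬ (lookup w i ≡ lookup w k × lookup w k < lookup w j)
  × ¬ (lookup w i < lookup w k × lookup w k < lookup w j)

-- nonincreasing sequence (element of 𝒫ₙ)
NonIncrSeq : ∀ {n} → Vec ℕ n → Set
NonIncrSeq u = NonIncr (toList u)

Positive : ∀ {n} → Vec ℕ n → Set
Positive u = NonIncrSeq u × All (1 ≤_) (toList u)

-- first term u₁ (only used for n ≥ 1)
first : ∀ {n} → Vec ℕ n → ℕ
first [] = 0
first (x ∷ _) = x

-- the order ⊴ of 𝒫ₙ : componentwise ≤, and every descent of v is a descent of u
_⊴_ : ∀ {n} → Vec ℕ n → Vec ℕ n → Set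
[] ⊴ [] = ⊤
(x ∷ []) ⊴ (y ∷ []) = x ≤ y
(x ∷ x' ∷ xs) ⊴ (y ∷ y' ∷ ys) =
  x ≤ y × (y' < y → x' < x) × ((x' ∷ xs) ⊴ (y' ∷ ys))

-- vertical encoding W(u): the nonincreasing word with u_i - u_{i+1}
-- letters n+1-i (i = 1..n), where u_{n+1} = 0.  For a sequence of
-- length k the letters used are k, k-1, …, 1 in that order.
W : ∀ {n} → Vec ℕ n → List ℕ
W [] = []
W {suc k} (x ∷ xs) = replicate (x ∸ first xs) (suc k) ++ W xs

-- Write #≥ ℓ w for the number of letters of w that are at least ℓ. The encodings
-- W u = NInc w and W v = Low w record exactly these counts and the word Low w, and
-- u ⊴ v holds because Low w is letterwise below w and uses only letters of w.
-- In a word avoiding aba and acb, the letters before any letter x form a block of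
-- letters above x followed by letters at most x. Hence w and Low w have equally many
-- letters above the last letter x, while for every ℓ with (last letter of Low w) ≤ ℓ < x
-- the word w has more: x is the least such ℓ where the counts agree. So the counts and
-- Low w determine the last letter, and removing it leaves data of the same kind. By
-- induction this gives uniqueness, and read backwards it builds the avoiding word for
-- every interval [u, v] of positive sequences with u₁ = v₁.

module Submission where

open import Defs
open import Algebra.Properties.CommutativeSemigroup using (interchange)
open import Data.Nat using (ℕ; zero; suc; _+_; _∸_; _⊓_; _≤_; _<_; _≤′_; ≤′-refl; ≤′-step; z≤n; s≤s; _≤?_; _<?_; _≟_)
open import Data.Nat.Properties
open import Data.Nat.ListAction using (sum)
open import Data.Nat.ListAction.Properties using (sum-++; sum-↭)
open import Data.List using (List; []; _∷_; _++_; _∷ʳ_; [_]; length; replicate; map; foldl; lookup; initLast; _∷ʳ′_)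
open import Data.List.Properties using (map-++; length-++; length-replicate; ∷ʳ-injectiveˡ; ∷ʳ-injectiveʳ; ∷-injectiveʳ)
open import Data.List.Relation.Unary.All as All using (All; []; _∷_)
open import Data.List.Relation.Unary.All.Properties using (++⁺; ++⁻ˡ; ++⁻; replicate⁺; ¬Any⇒All¬)
open import Data.List.Relation.Unary.Any using (here; there; index)
open import Data.List.Relation.Unary.Any.Properties using (lookup-index)
open import Data.List.Membership.Propositional using (_∈_)
open import Data.List.Membership.Propositional.Properties using (∈-++⁺ˡ; ∈-++⁺ʳ; ∈-lookup)
open import Data.List.Membership.DecPropositional _≟_ using (_∈?_)
open import Data.List.Relation.Binary.Permutation.Propositional using (_↭_; ↭-refl; ↭-sym; ↭-trans; prep; swap)
open import Data.List.Relation.Binary.Permutation.Propositional.Properties using (map⁺; ∈-resp-↭; All-resp-↭; ↭-length)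
open import Data.Vec using (Vec; []; _∷_; toList)
open import Data.Fin using (Fin)
import Data.Fin as Fin
open import Data.Product using (Σ; _×_; _,_; proj₁; proj₂; ∃!)
open import Data.Sum using (_⊎_; inj₁; inj₂; [_,_]′)
open import Data.Empty using (⊥-elim)
open import Data.Unit using (⊤; tt)
open import Function using (_∘_)
open import Relation.Nullary using (¬_; yes; no; Dec)
open import Relation.Nullary.Decidable using (toSum)
open import Relation.Binary.Definitions using (tri<; tri≈; tri>)
open import Relation.Binary.PropositionalEquality using (_≡_; _≢_; refl; sym; trans; cong; cong₂; subst; subst₂; module ≡-Reasoning)

atLeast : ℕ → ℕ → ℕ
atLeast zero    _       = 1
atLeast (suc ℓ) zero    = 0
atLeast (suc ℓ) (suc a) = atLeast ℓ a

atLeast-yes : ∀ {ℓ a} → ℓ ≤ a → atLeast ℓ a ≡ 1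
atLeast-yes {zero}  _       = refl
atLeast-yes {suc ℓ} (s≤s p) = atLeast-yes p

atLeast-no : ∀ {ℓ a} → a < ℓ → atLeast ℓ a ≡ 0
atLeast-no {suc ℓ} {zero}  _       = refl
atLeast-no {suc ℓ} {suc a} (s≤s p) = atLeast-no p

atLeast-≤1 : ∀ ℓ a → atLeast ℓ a ≤ 1
atLeast-≤1 ℓ a with ℓ ≤? a
... | yes p = ≤-reflexive (atLeast-yes p)
... | no p  = ≤-trans (≤-reflexive (atLeast-no (≰⇒> p))) z≤n

atLeast-monoʳ-≤ : ∀ ℓ {a b} → a ≤ b → atLeast ℓ a ≤ atLeast ℓ b
atLeast-monoʳ-≤ zero    _       = ≤-refl
atLeast-monoʳ-≤ (suc ℓ) {zero}  _       = z≤n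
atLeast-monoʳ-≤ (suc ℓ) {suc a} (s≤s p) = atLeast-monoʳ-≤ ℓ p

atLeast-antiˡ-≤ : ∀ {ℓ ℓ′} a → ℓ ≤ ℓ′ → atLeast ℓ′ a ≤ atLeast ℓ a
atLeast-antiˡ-≤ {ℓ} {ℓ′} a p with ℓ′ ≤? a
... | yes q = ≤-reflexive (trans (atLeast-yes q) (sym (atLeast-yes (≤-trans p q))))
... | no q  = ≤-trans (≤-reflexive (atLeast-no (≰⇒> q))) z≤n

atLeast-complement : ∀ a j → atLeast a j + atLeast (suc j) a ≡ 1
atLeast-complement zero    j       = refl
atLeast-complement (suc a) zero    = refl
atLeast-complement (suc a) (suc j) = atLeast-complement a j

atLeast-sucʳ : ∀ {c} j → c ≢ suc j → atLeast c j ≡ atLeast c (suc j)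
atLeast-sucʳ {c} j c≢1+j with c ≤? j | c ≤? suc j
... | yes p | _     = trans (atLeast-yes p) (sym (atLeast-yes (m≤n⇒m≤1+n p)))
... | no p  | yes q = ⊥-elim (c≢1+j (≤-antisym q (≰⇒> p)))
... | no p  | no q  = trans (atLeast-no (≰⇒> p)) (sym (atLeast-no (≰⇒> q)))

tally : (ℕ → ℕ) → List ℕ → ℕ
tally f w = sum (map f w)

tally-++ : ∀ f u w → tally f (u ++ w) ≡ tally f u + tally f w
tally-++ f u w = trans (cong sum (map-++ f u w)) (sum-++ (map f u) (map f w))

tally-∷ʳ : ∀ f w x → tally f (w ∷ʳ x) ≡ tally f w + f x
tally-∷ʳ f w x = trans (tally-++ f w [ x ]) (cong (tally f w +_) (+-identityʳ (f x)))

tally-↭ : ∀ f {u w} → u ↭ w → tally f u ≡ tally f w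
tally-↭ f p = sum-↭ (map⁺ f p)

tally-mono-≤ : ∀ {f g} → (∀ a → f a ≤ g a) → ∀ w → tally f w ≤ tally g w
tally-mono-≤ f≤g []      = z≤n
tally-mono-≤ f≤g (a ∷ w) = +-mono-≤ (f≤g a) (tally-mono-≤ f≤g w)

tally-≡0 : ∀ {f w} → All (λ a → f a ≡ 0) w → tally f w ≡ 0
tally-≡0 []         = refl
tally-≡0 {f} {_ ∷ w} (fa≡0 ∷ p) = trans (cong (_+ tally f w) fa≡0) (tally-≡0 p)

tally-≡length : ∀ {f w} → All (λ a → f a ≡ 1) w → tally f w ≡ length w
tally-≡length []         = refl
tally-≡length {f} {_ ∷ w} (fa≡1 ∷ p) = trans (cong (_+ tally f w) fa≡1) (cong suc (tally-≡length p))

tally-≤length : ∀ {f} → (∀ a → f a ≤ 1) → ∀ w → tally f w ≤ length w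
tally-≤length f≤1 []      = z≤n
tally-≤length f≤1 (a ∷ w) = +-mono-≤ (f≤1 a) (tally-≤length f≤1 w)

#≥ : ℕ → List ℕ → ℕ
#≥ ℓ = tally (atLeast ℓ)

#≤ : ℕ → List ℕ → ℕ
#≤ j = tally (λ a → atLeast a j)

#≥0≡length : ∀ w → #≥ 0 w ≡ length w
#≥0≡length w = tally-≡length (All.universal (λ _ → refl) w)

#≥≤length : ∀ ℓ w → #≥ ℓ w ≤ length w
#≥≤length ℓ = tally-≤length (atLeast-≤1 ℓ)

#≥-suc-≤ : ∀ ℓ w → #≥ (suc ℓ) w ≤ #≥ ℓ w
#≥-suc-≤ ℓ = tally-mono-≤ (λ a → atLeast-antiˡ-≤ a (n≤1+n ℓ))

#≥≡0 : ∀ {ℓ w} → All (_< ℓ) w → #≥ ℓ w ≡ 0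
#≥≡0 p = tally-≡0 (All.map atLeast-no p)

#>≡0⇒All≤ : ∀ {x} w → #≥ (suc x) w ≡ 0 → All (_≤ x) w
#>≡0⇒All≤     []      _ = []
#>≡0⇒All≤ {x} (a ∷ w) e with x <? a
... | yes x<a = ⊥-elim (0≢1+n (trans (sym e) (cong (_+ #≥ (suc x) w) (atLeast-yes x<a))))
... | no x≮a  = ≮⇒≥ x≮a ∷ #>≡0⇒All≤ w (trans (sym (cong (_+ #≥ (suc x) w) (atLeast-no (s≤s (≮⇒≥ x≮a))))) e)

#≤+#>≡length : ∀ j w → #≤ j w + #≥ (suc j) w ≡ length w
#≤+#>≡length j []      = refl
#≤+#>≡length j (a ∷ w) =
  trans (interchange +-commutativeSemigroup (atLeast a j) (#≤ j w) (atLeast (suc j) a) (#≥ (suc j) w))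
        (cong₂ _+_ (atLeast-complement a j) (#≤+#>≡length j w))

∈⇒#>-<-#≥ : ∀ {r w} → r ∈ w → #≥ (suc r) w < #≥ r w
∈⇒#>-<-#≥ {r} {_ ∷ w} (here refl) rewrite atLeast-no {suc r} {r} ≤-refl | atLeast-yes {r} {r} ≤-refl =
  s≤s (#≥-suc-≤ r w)
∈⇒#>-<-#≥ {r} {a ∷ w} (there r∈w) = +-mono-≤-< (atLeast-antiˡ-≤ a (n≤1+n r)) (∈⇒#>-<-#≥ r∈w)

#≤-suc-≥ : ∀ j w → #≤ j w ≤ #≤ (suc j) w
#≤-suc-≥ j = tally-mono-≤ (λ a → atLeast-monoʳ-≤ a (n≤1+n j))

∈⇒#≤-<-#≤suc : ∀ {j w} → suc j ∈ w → #≤ j w < #≤ (suc j) w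
∈⇒#≤-<-#≤suc {j} {_ ∷ w} (here refl) rewrite atLeast-no {suc j} {j} ≤-refl | atLeast-yes {suc j} {suc j} ≤-refl =
  s≤s (#≤-suc-≥ j w)
∈⇒#≤-<-#≤suc {j} {a ∷ w} (there 1+j∈w) = +-mono-≤-< (atLeast-monoʳ-≤ a (n≤1+n j)) (∈⇒#≤-<-#≤suc 1+j∈w)

#≤-<-#≤suc⇒∈ : ∀ {j} w → #≤ j w < #≤ (suc j) w → suc j ∈ w
#≤-<-#≤suc⇒∈ {j} (a ∷ w) lt with a ≟ suc j
... | yes refl = here refl
... | no a≢1+j = there (#≤-<-#≤suc⇒∈ w (+-cancelˡ-< (atLeast a j) _ _
                   (subst (λ t → atLeast a j + #≤ j w < t + #≤ (suc j) w) (sym (atLeast-sucʳ j a≢1+j)) lt)))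

∈⇒1≤#≤ : ∀ {r j w} → r ∈ w → r ≤ j → 1 ≤ #≤ j w
∈⇒1≤#≤ {w = a ∷ w} (here refl) r≤j = ≤-trans (≤-reflexive (sym (atLeast-yes r≤j))) (m≤m+n _ _)
∈⇒1≤#≤ {w = a ∷ w} (there r∈w) r≤j = ≤-trans (∈⇒1≤#≤ r∈w r≤j) (m≤n+m _ _)

#≤≡length : ∀ {j w} → All (_≤ j) w → #≤ j w ≡ length w
#≤≡length p = tally-≡length (All.map atLeast-yes p)

#≤≡0 : ∀ {j w} → All (j <_) w → #≤ j w ≡ 0
#≤≡0 p = tally-≡0 (All.map atLeast-no p)

#≤-replicate-++ : ∀ {j a} c w → j < a → #≤ j (replicate c a ++ w) ≡ #≤ j w
#≤-replicate-++ {j} {a} c w j<a =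
  trans (tally-++ _ (replicate c a) w)
        (cong (_+ #≤ j w) (#≤≡0 (replicate⁺ c j<a)))

length-∷ʳ : ∀ (w : List ℕ) x → length (w ∷ʳ x) ≡ suc (length w)
length-∷ʳ w x = trans (length-++ w) (+-comm (length w) 1)

nonIncr-∷ : ∀ {a w} → NonIncr w → All (_≤ a) w → NonIncr (a ∷ w)
nonIncr-∷ ni-[]       []      = ni-[x]
nonIncr-∷ ni-[x]      (p ∷ _) = ni-∷ p ni-[x]
nonIncr-∷ (ni-∷ q ni) (p ∷ _) = ni-∷ p (ni-∷ q ni)

nonIncr-tail : ∀ {a w} → NonIncr (a ∷ w) → NonIncr w
nonIncr-tail ni-[x]      = ni-[]
nonIncr-tail (ni-∷ _ ni) = ni

nonIncr-head-max : ∀ {a w} → NonIncr (a ∷ w) → All (_≤ a) w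
nonIncr-head-max ni-[x]      = []
nonIncr-head-max (ni-∷ p ni) = p ∷ All.map (λ q → ≤-trans q p) (nonIncr-head-max ni)

nonIncr-replicate-++ : ∀ c {a w} → NonIncr w → All (_≤ a) w → NonIncr (replicate c a ++ w)
nonIncr-replicate-++ zero    ni _   = ni
nonIncr-replicate-++ (suc c) ni w≤a =
  nonIncr-∷ (nonIncr-replicate-++ c ni w≤a) (++⁺ (replicate⁺ c ≤-refl) w≤a)

nonIncr-∷ʳ⁻ : ∀ w {m} → NonIncr (w ∷ʳ m) → NonIncr w × All (m ≤_) w
nonIncr-∷ʳ⁻ []      _  = ni-[] , []
nonIncr-∷ʳ⁻ (a ∷ w) ni with nonIncr-∷ʳ⁻ w (nonIncr-tail ni) | nonIncr-head-max ni
... | niw , m≤w | w∷ʳm≤a =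
  nonIncr-∷ niw (++⁻ˡ w w∷ʳm≤a) , All.lookup w∷ʳm≤a (∈-++⁺ʳ w (here refl)) ∷ m≤w

insertDesc-↭ : ∀ x w → insertDesc x w ↭ x ∷ w
insertDesc-↭ x []      = ↭-refl
insertDesc-↭ x (y ∷ w) with y ≤? x
... | yes _ = ↭-refl
... | no _  = ↭-trans (prep y (insertDesc-↭ x w)) (swap y x ↭-refl)

insertDesc-All : ∀ {P : ℕ → Set} {x} w → P x → All P w → All P (insertDesc x w)
insertDesc-All w px pw = All-resp-↭ (↭-sym (insertDesc-↭ _ w)) (px ∷ pw)

insertDesc-nonIncr : ∀ {x} w → NonIncr w → NonIncr (insertDesc x w)
insertDesc-nonIncr     []      _  = ni-[x]
insertDesc-nonIncr {x} (y ∷ w) ni with y ≤? x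
... | yes y≤x = ni-∷ y≤x ni
... | no y≰x  = nonIncr-∷ (insertDesc-nonIncr w (nonIncr-tail ni))
                          (insertDesc-All w (<⇒≤ (≰⇒> y≰x)) (nonIncr-head-max ni))

NInc-nonIncr : ∀ w → NonIncr (NInc w)
NInc-nonIncr []      = ni-[]
NInc-nonIncr (x ∷ w) = insertDesc-nonIncr (NInc w) (NInc-nonIncr w)

NInc-↭ : ∀ w → NInc w ↭ w
NInc-↭ []      = ↭-refl
NInc-↭ (x ∷ w) = ↭-trans (insertDesc-↭ x (NInc w)) (prep x (NInc-↭ w))

nonIncr-#≥≡0 : ∀ {x y u} → NonIncr (x ∷ u) → x < y → #≥ y (x ∷ u) ≡ 0
nonIncr-#≥≡0 ni x<y = #≥≡0 (x<y ∷ All.map (λ q → ≤-<-trans q x<y) (nonIncr-head-max ni))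

#≥-head-pos : ∀ y w → 0 < #≥ y (y ∷ w)
#≥-head-pos y w = ≤-trans (≤-reflexive (sym (atLeast-yes {y} ≤-refl))) (m≤m+n _ _)

nonIncr-≡ : ∀ {u w} → NonIncr u → NonIncr w → (∀ ℓ → #≥ ℓ u ≡ #≥ ℓ w) → u ≡ w
nonIncr-≡ {[]}    {[]}    _ _ _ = refl
nonIncr-≡ {[]}    {y ∷ w} _ _ h = ⊥-elim (n≮0 (subst (0 <_) (sym (h y)) (#≥-head-pos y w)))
nonIncr-≡ {x ∷ u} {[]}    _ _ h = ⊥-elim (n≮0 (subst (0 <_) (h x) (#≥-head-pos x u)))
nonIncr-≡ {x ∷ u} {y ∷ w} niu niw h with <-cmp x y
... | tri< x<y _ _ = ⊥-elim (n≮0 (subst (0 <_) (trans (sym (h y)) (nonIncr-#≥≡0 niu x<y)) (#≥-head-pos y w)))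
... | tri> _ _ y<x = ⊥-elim (n≮0 (subst (0 <_) (trans (h x) (nonIncr-#≥≡0 niw y<x)) (#≥-head-pos x u)))
... | tri≈ _ refl _ = cong (x ∷_) (nonIncr-≡ (nonIncr-tail niu) (nonIncr-tail niw)
                                     (λ ℓ → +-cancelˡ-≡ (atLeast ℓ x) _ _ (h ℓ)))

⊓-closed : ∀ {P : ℕ → Set} {m a} → P m → P a → P (m ⊓ a)
⊓-closed {P} {m} {a} pm pa with ⊓-sel m a
... | inj₁ m⊓a≡m = subst P (sym m⊓a≡m) pm
... | inj₂ m⊓a≡a = subst P (sym m⊓a≡a) pa

length-lowFrom : ∀ m w → length (lowFrom m w) ≡ length w
length-lowFrom m []      = refl
length-lowFrom m (a ∷ w) = cong suc (length-lowFrom (m ⊓ a) w)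

length-Low : ∀ w → length (Low w) ≡ length w
length-Low []      = refl
length-Low (a ∷ w) = cong suc (length-lowFrom a w)

lowFrom-nonIncr : ∀ m w → NonIncr (m ∷ lowFrom m w)
lowFrom-nonIncr m []      = ni-[x]
lowFrom-nonIncr m (a ∷ w) = ni-∷ (m⊓n≤m m a) (lowFrom-nonIncr (m ⊓ a) w)

Low-nonIncr : ∀ w → NonIncr (Low w)
Low-nonIncr []      = ni-[]
Low-nonIncr (a ∷ w) = lowFrom-nonIncr a w

lowFrom-All : ∀ {P : ℕ → Set} {m} w → P m → All P w → All P (lowFrom m w)
lowFrom-All []      _  []        = []
lowFrom-All {P} (a ∷ w) pm (pa ∷ pw) = ⊓-closed {P} pm pa ∷ lowFrom-All w (⊓-closed {P} pm pa) pw

Low-All : ∀ {P : ℕ → Set} w → All P w → All P (Low w)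
Low-All []      []        = []
Low-All (a ∷ w) (pa ∷ pw) = pa ∷ lowFrom-All w pa pw

lowFrom-≤ : ∀ m w → All (_≤ m) (lowFrom m w)
lowFrom-≤ m []      = []
lowFrom-≤ m (a ∷ w) = m⊓n≤m m a ∷ All.map (λ q → ≤-trans q (m⊓n≤m m a)) (lowFrom-≤ (m ⊓ a) w)

lowFrom-All-≤ : ∀ {x} m w → All (_≤ x) w → All (_≤ x) (lowFrom m w)
lowFrom-All-≤ m []      []       = []
lowFrom-All-≤ m (a ∷ w) (p ∷ ps) = ≤-trans (m⊓n≤n m a) p ∷ lowFrom-All-≤ (m ⊓ a) w ps

∈-lowFrom : ∀ {b m w} → b ≤ m → All (b ≤_) w → b ∈ w → b ∈ lowFrom m w
∈-lowFrom {m = m} b≤m (b≤a ∷ _)  (here refl) = here (sym (m≥n⇒m⊓n≡n b≤m))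
∈-lowFrom b≤m (b≤a ∷ b≤w) (there b∈w) = there (∈-lowFrom (⊓-glb b≤m b≤a) b≤w b∈w)

∈-Low : ∀ {b w} → All (b ≤_) w → b ∈ w → b ∈ Low w
∈-Low _           (here refl) = here refl
∈-Low (b≤a ∷ b≤w) (there b∈w) = there (∈-lowFrom b≤a b≤w b∈w)

∈-lowFrom⁻ : ∀ {b} m w → b ∈ lowFrom m w → b ≡ m ⊎ b ∈ w
∈-lowFrom⁻ m (a ∷ w) (here refl) with ⊓-sel m a
... | inj₁ e = inj₁ e
... | inj₂ e = inj₂ (here e)
∈-lowFrom⁻ m (a ∷ w) (there b∈) with ∈-lowFrom⁻ (m ⊓ a) w b∈
... | inj₂ b∈w = inj₂ (there b∈w)
... | inj₁ e with ⊓-sel m a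
...   | inj₁ e′ = inj₁ (trans e e′)
...   | inj₂ e′ = inj₂ (here (trans e e′))

∈-Low⁻ : ∀ {b} w → b ∈ Low w → b ∈ w
∈-Low⁻ (a ∷ w) (here refl) = here refl
∈-Low⁻ (a ∷ w) (there b∈) with ∈-lowFrom⁻ a w b∈
... | inj₁ e   = here e
... | inj₂ b∈w = there b∈w

#≥-lowFrom-≤ : ∀ ℓ m w → #≥ ℓ (lowFrom m w) ≤ #≥ ℓ w
#≥-lowFrom-≤ ℓ m []      = z≤n
#≥-lowFrom-≤ ℓ m (a ∷ w) = +-mono-≤ (atLeast-monoʳ-≤ ℓ (m⊓n≤n m a)) (#≥-lowFrom-≤ ℓ (m ⊓ a) w)

#≥-Low-≤ : ∀ ℓ w → #≥ ℓ (Low w) ≤ #≥ ℓ w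
#≥-Low-≤ ℓ []      = z≤n
#≥-Low-≤ ℓ (a ∷ w) = +-monoʳ-≤ (atLeast ℓ a) (#≥-lowFrom-≤ ℓ a w)

#≤-lowFrom-≥ : ∀ j m w → #≤ j w ≤ #≤ j (lowFrom m w)
#≤-lowFrom-≥ j m []      = z≤n
#≤-lowFrom-≥ j m (a ∷ w) = +-mono-≤ (atLeast-antiˡ-≤ j (m⊓n≤n m a)) (#≤-lowFrom-≥ j (m ⊓ a) w)

#≤-Low-≥ : ∀ j w → #≤ j w ≤ #≤ j (Low w)
#≤-Low-≥ j []      = z≤n
#≤-Low-≥ j (a ∷ w) = +-monoʳ-≤ (atLeast a j) (#≤-lowFrom-≥ j a w)

lowFrom-∷ʳ : ∀ m w x → lowFrom m (w ∷ʳ x) ≡ lowFrom m w ∷ʳ (foldl _⊓_ m w ⊓ x)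
lowFrom-∷ʳ m []      x = refl
lowFrom-∷ʳ m (a ∷ w) x = cong ((m ⊓ a) ∷_) (lowFrom-∷ʳ (m ⊓ a) w x)

lastLow : List ℕ → ℕ → ℕ
lastLow []      x = x
lastLow (a ∷ w) x = foldl _⊓_ a w ⊓ x

Low-∷ʳ : ∀ w x → Low (w ∷ʳ x) ≡ Low w ∷ʳ lastLow w x
Low-∷ʳ []      x = refl
Low-∷ʳ (a ∷ w) x = cong (a ∷_) (lowFrom-∷ʳ a w x)

lastLow-≤ : ∀ w x → lastLow w x ≤ x
lastLow-≤ []      x = ≤-refl
lastLow-≤ (a ∷ w) x = m⊓n≤n _ x

lowFrom-last : ∀ m w ys {m′} → m ∷ lowFrom m w ≡ ys ∷ʳ m′ → foldl _⊓_ m w ≡ m′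
lowFrom-last m []      []           refl = refl
lowFrom-last m []      (_ ∷ [])     ()
lowFrom-last m []      (_ ∷ _ ∷ _) ()
lowFrom-last m (a ∷ w) []           ()
lowFrom-last m (a ∷ w) (_ ∷ ys)     e = lowFrom-last (m ⊓ a) w ys (∷-injectiveʳ e)

lastLow-∷ʳ : ∀ w x ys {m} → Low w ≡ ys ∷ʳ m → lastLow w x ≡ m ⊓ x
lastLow-∷ʳ []      x []      ()
lastLow-∷ʳ []      x (_ ∷ _) ()
lastLow-∷ʳ (a ∷ w) x ys      e = cong (_⊓ x) (lowFrom-last a w ys e)

-- Avoiding aba and acb

DescentsBelowEarlier : List ℕ → Set
DescentsBelowEarlier w = (i j k : Fin (length w)) → i Fin.< j → j Fin.< k →
  lookup w k < lookup w j → lookup w k < lookup w i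

Avoids⇒DescentsBelowEarlier : ∀ w → Avoids-aba-acb w → DescentsBelowEarlier w
Avoids⇒DescentsBelowEarlier w av i j k i<j j<k wk<wj with av i j k i<j j<k | <-cmp (lookup w i) (lookup w k)
... | _       , no-acb | tri< wi<wk _ _ = ⊥-elim (no-acb (wi<wk , wk<wj))
... | no-aba  , _      | tri≈ _ wi≡wk _ = ⊥-elim (no-aba (wi≡wk , wk<wj))
... | _       , _      | tri> _ _ wk<wi = wk<wi

DescentsBelowEarlier⇒Avoids : ∀ w → DescentsBelowEarlier w → Avoids-aba-acb w
DescentsBelowEarlier⇒Avoids w d i j k i<j j<k =
  (λ (wi≡wk , wk<wj) → <-irrefl (sym wi≡wk) (d i j k i<j j<k wk<wj)) ,
  (λ (wi<wk , wk<wj) → <-asym wi<wk (d i j k i<j j<k wk<wj))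

DescentsBelow : ℕ → List ℕ → Set
DescentsBelow a []      = ⊤
DescentsBelow a (b ∷ w) = All (λ c → c < b → c < a) w × DescentsBelow a w

Avoiding : List ℕ → Set
Avoiding []      = ⊤
Avoiding (a ∷ w) = DescentsBelow a w × Avoiding w

DescentsBelow⇒lookup : ∀ {a} w → DescentsBelow a w → (j k : Fin (length w)) → j Fin.< k →
  lookup w k < lookup w j → lookup w k < a
DescentsBelow⇒lookup (b ∷ w) (below , _) Fin.zero    (Fin.suc k) _         = All.lookup below (∈-lookup k)
DescentsBelow⇒lookup (b ∷ w) (_ , rest)  (Fin.suc j) (Fin.suc k) (s≤s j<k) = DescentsBelow⇒lookup w rest j k j<k

lookup⇒DescentsBelow : ∀ {a} w → ((j k : Fin (length w)) → j Fin.< k →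
  lookup w k < lookup w j → lookup w k < a) → DescentsBelow a w
lookup⇒DescentsBelow []      _ = tt
lookup⇒DescentsBelow (b ∷ w) d =
  All.tabulate (λ c∈w → subst (λ c → c < b → c < _) (sym (lookup-index c∈w)) (d Fin.zero (Fin.suc (index c∈w)) (s≤s z≤n))) ,
  lookup⇒DescentsBelow w (λ j k j<k → d (Fin.suc j) (Fin.suc k) (s≤s j<k))

Avoiding⇒DescentsBelowEarlier : ∀ w → Avoiding w → DescentsBelowEarlier w
Avoiding⇒DescentsBelowEarlier (a ∷ w) (below , _) Fin.zero (Fin.suc j) (Fin.suc k) _ (s≤s j<k) =
  DescentsBelow⇒lookup w below j k j<k
Avoiding⇒DescentsBelowEarlier (a ∷ w) (_ , rest) (Fin.suc i) (Fin.suc j) (Fin.suc k) (s≤s i<j) (s≤s j<k) =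
  Avoiding⇒DescentsBelowEarlier w rest i j k i<j j<k

DescentsBelowEarlier⇒Avoiding : ∀ w → DescentsBelowEarlier w → Avoiding w
DescentsBelowEarlier⇒Avoiding []      _ = tt
DescentsBelowEarlier⇒Avoiding (a ∷ w) d =
  lookup⇒DescentsBelow w (λ j k j<k → d Fin.zero (Fin.suc j) (Fin.suc k) (s≤s z≤n) (s≤s j<k)) ,
  DescentsBelowEarlier⇒Avoiding w (λ i j k i<j j<k → d (Fin.suc i) (Fin.suc j) (Fin.suc k) (s≤s i<j) (s≤s j<k))

Avoids⇒Avoiding : ∀ w → Avoids-aba-acb w → Avoiding w
Avoids⇒Avoiding w av = DescentsBelowEarlier⇒Avoiding w (Avoids⇒DescentsBelowEarlier w av)

Avoiding⇒Avoids : ∀ w → Avoiding w → Avoids-aba-acb w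
Avoiding⇒Avoids w t = DescentsBelowEarlier⇒Avoids w (Avoiding⇒DescentsBelowEarlier w t)

AboveFirst : ℕ → List ℕ → Set
AboveFirst x []      = ⊤
AboveFirst x (a ∷ w) = All (λ b → x < b → x < a) w × AboveFirst x w

data AboveThenAtMost (x : ℕ) : List ℕ → Set where
  atMost : ∀ {w} → All (_≤ x) w → AboveThenAtMost x w
  above  : ∀ {a w} → x < a → AboveThenAtMost x w → AboveThenAtMost x (a ∷ w)

AboveThenAtMost⇒AboveFirst : ∀ {x} w → AboveThenAtMost x w → AboveFirst x w
AboveThenAtMost⇒AboveFirst []      _                    = tt
AboveThenAtMost⇒AboveFirst (a ∷ w) (atMost (_ ∷ w≤x)) =
  All.map (λ b≤x x<b → ⊥-elim (<⇒≱ x<b b≤x)) w≤x , AboveThenAtMost⇒AboveFirst w (atMost w≤x)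
AboveThenAtMost⇒AboveFirst (a ∷ w) (above x<a c)       =
  All.universal (λ _ _ → x<a) w , AboveThenAtMost⇒AboveFirst w c

AboveFirst⇒AboveThenAtMost : ∀ {x} w → AboveFirst x w → AboveThenAtMost x w
AboveFirst⇒AboveThenAtMost     []      _ = atMost []
AboveFirst⇒AboveThenAtMost {x} (a ∷ w) (above⇒ , rest) with x <? a
... | yes x<a = above x<a (AboveFirst⇒AboveThenAtMost w rest)
... | no x≮a  = atMost (≮⇒≥ x≮a ∷ All.map (λ f → ≮⇒≥ (λ x<b → x≮a (f x<b))) above⇒)

DescentsBelow-∷ʳ⁺ : ∀ a w x → DescentsBelow a w → All (λ b → x < b → x < a) w → DescentsBelow a (w ∷ʳ x)
DescentsBelow-∷ʳ⁺ a []      x _           _        = [] , tt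
DescentsBelow-∷ʳ⁺ a (b ∷ w) x (d₁ , d₂) (p ∷ ps) = ++⁺ d₁ (p ∷ []) , DescentsBelow-∷ʳ⁺ a w x d₂ ps

DescentsBelow-∷ʳ⁻ : ∀ a w x → DescentsBelow a (w ∷ʳ x) → DescentsBelow a w × All (λ b → x < b → x < a) w
DescentsBelow-∷ʳ⁻ a []      x _ = tt , []
DescentsBelow-∷ʳ⁻ a (b ∷ w) x (d₁ , d₂) with DescentsBelow-∷ʳ⁻ a w x d₂ | ++⁻ w d₁
... | e₁ , e₂ | f₁ , (f₂ ∷ []) = (f₁ , e₁) , (f₂ ∷ e₂)

Avoiding-∷ʳ⁺ : ∀ w x → Avoiding w → AboveFirst x w → Avoiding (w ∷ʳ x)
Avoiding-∷ʳ⁺ []      x _       _        = tt , tt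
Avoiding-∷ʳ⁺ (a ∷ w) x (d , t) (p , ps) = DescentsBelow-∷ʳ⁺ a w x d p , Avoiding-∷ʳ⁺ w x t ps

Avoiding-∷ʳ⁻ : ∀ w x → Avoiding (w ∷ʳ x) → Avoiding w × AboveFirst x w
Avoiding-∷ʳ⁻ []      x _       = tt , tt
Avoiding-∷ʳ⁻ (a ∷ w) x (d , t) with DescentsBelow-∷ʳ⁻ a w x d | Avoiding-∷ʳ⁻ w x t
... | d₁ , d₂ | t₁ , t₂ = (d₁ , t₁) , (d₂ , t₂)

-- Low w keeps a letter above x exactly while the running minimum stays above x.
AboveThenAtMost⇒#>-lowFrom : ∀ {x} m w → x < m → AboveThenAtMost x w → #≥ (suc x) w ≡ #≥ (suc x) (lowFrom m w)
AboveThenAtMost⇒#>-lowFrom m w _ (atMost w≤x) =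
  trans (#≥≡0 (All.map s≤s w≤x)) (sym (#≥≡0 (All.map s≤s (lowFrom-All-≤ m w w≤x))))
AboveThenAtMost⇒#>-lowFrom {x} m (a ∷ w) x<m (above x<a c)
  rewrite atLeast-yes {suc x} {a} x<a | atLeast-yes {suc x} {m ⊓ a} (⊓-glb x<m x<a) =
  cong suc (AboveThenAtMost⇒#>-lowFrom (m ⊓ a) w (⊓-glb x<m x<a) c)

AboveThenAtMost⇒#>-Low : ∀ {x} w → AboveThenAtMost x w → #≥ (suc x) w ≡ #≥ (suc x) (Low w)
AboveThenAtMost⇒#>-Low w (atMost w≤x) =
  trans (#≥≡0 (All.map s≤s w≤x)) (sym (#≥≡0 (All.map s≤s (Low-All w w≤x))))
AboveThenAtMost⇒#>-Low {x} (a ∷ w) (above x<a c) rewrite atLeast-yes {suc x} {a} x<a =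
  cong suc (AboveThenAtMost⇒#>-lowFrom a w x<a c)

#>-lowFrom⇒AboveThenAtMost : ∀ {x} m w → #≥ (suc x) w ≡ #≥ (suc x) (lowFrom m w) → AboveThenAtMost x w
#>-lowFrom⇒AboveThenAtMost     m []      _ = atMost []
#>-lowFrom⇒AboveThenAtMost {x} m (a ∷ w) e with x <? m ⊓ a
... | yes x<m⊓a rewrite atLeast-yes {suc x} {a} (<-≤-trans x<m⊓a (m⊓n≤n m a)) | atLeast-yes {suc x} {m ⊓ a} x<m⊓a =
  above (<-≤-trans x<m⊓a (m⊓n≤n m a)) (#>-lowFrom⇒AboveThenAtMost (m ⊓ a) w (suc-injective e))
... | no x≮m⊓a = atMost (#>≡0⇒All≤ (a ∷ w) (trans e (#≥≡0 (All.map s≤s low≤x))))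
  where
  low≤x : All (_≤ x) (lowFrom m (a ∷ w))
  low≤x = ≮⇒≥ x≮m⊓a ∷ All.map (λ q → ≤-trans q (≮⇒≥ x≮m⊓a)) (lowFrom-≤ (m ⊓ a) w)

#>-Low⇒AboveThenAtMost : ∀ {x} w → #≥ (suc x) w ≡ #≥ (suc x) (Low w) → AboveThenAtMost x w
#>-Low⇒AboveThenAtMost     []      _ = atMost []
#>-Low⇒AboveThenAtMost {x} (a ∷ w) e with x <? a
... | yes x<a rewrite atLeast-yes {suc x} {a} x<a = above x<a (#>-lowFrom⇒AboveThenAtMost a w (suc-injective e))
... | no x≮a = atMost (#>≡0⇒All≤ (a ∷ w) (trans e (#≥≡0 (All.map s≤s low≤x))))
  where
  low≤x : All (_≤ x) (Low (a ∷ w))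
  low≤x = ≮⇒≥ x≮a ∷ All.map (λ q → ≤-trans q (≮⇒≥ x≮a)) (lowFrom-≤ a w)

-- The last letter of an avoiding word

Avoiding-∷ʳ⇒#>-Low : ∀ w x → Avoiding (w ∷ʳ x) → #≥ (suc x) (w ∷ʳ x) ≡ #≥ (suc x) (Low (w ∷ʳ x))
Avoiding-∷ʳ⇒#>-Low w x t = begin
  #≥ (suc x) (w ∷ʳ x)                             ≡⟨ tally-∷ʳ (atLeast (suc x)) w x ⟩
  #≥ (suc x) w + atLeast (suc x) x                ≡⟨ cong₂ _+_ w-split last-absent ⟩
  #≥ (suc x) (Low w) + atLeast (suc x) (lastLow w x) ≡⟨ tally-∷ʳ (atLeast (suc x)) (Low w) (lastLow w x) ⟨
  #≥ (suc x) (Low w ∷ʳ lastLow w x)               ≡⟨ cong (#≥ (suc x)) (Low-∷ʳ w x) ⟨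
  #≥ (suc x) (Low (w ∷ʳ x))                       ∎
  where
  open ≡-Reasoning
  w-split : #≥ (suc x) w ≡ #≥ (suc x) (Low w)
  w-split = AboveThenAtMost⇒#>-Low w (AboveFirst⇒AboveThenAtMost w (proj₂ (Avoiding-∷ʳ⁻ w x t)))
  last-absent : atLeast (suc x) x ≡ atLeast (suc x) (lastLow w x)
  last-absent = trans (atLeast-no {suc x} ≤-refl) (sym (atLeast-no (s≤s (lastLow-≤ w x))))

#>-Low-∷ʳ-< : ∀ w x ℓ → lastLow w x ≤ ℓ → ℓ < x → #≥ (suc ℓ) (Low (w ∷ʳ x)) < #≥ (suc ℓ) (w ∷ʳ x)
#>-Low-∷ʳ-< w x ℓ min≤ℓ ℓ<x
  rewrite Low-∷ʳ w x | tally-∷ʳ (atLeast (suc ℓ)) (Low w) (lastLow w x) | tally-∷ʳ (atLeast (suc ℓ)) w x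
        | atLeast-no {suc ℓ} {lastLow w x} (s≤s min≤ℓ) | atLeast-yes {suc ℓ} {x} ℓ<x
        | +-identityʳ (#≥ (suc ℓ) (Low w)) | +-comm (#≥ (suc ℓ) w) 1 = s≤s (#≥-Low-≤ (suc ℓ) w)

Avoiding-∷ʳ-last-≮ : ∀ u x w y → Avoiding (u ∷ʳ x) → (∀ ℓ → #≥ ℓ (u ∷ʳ x) ≡ #≥ ℓ (w ∷ʳ y)) →
  Low (u ∷ʳ x) ≡ Low (w ∷ʳ y) → ¬ x < y
Avoiding-∷ʳ-last-≮ u x w y t same-counts same-Low x<y = <-irrefl refl (begin-strict
  #≥ (suc x) (Low (u ∷ʳ x))  ≡⟨ cong (#≥ (suc x)) same-Low ⟩
  #≥ (suc x) (Low (w ∷ʳ y))  <⟨ #>-Low-∷ʳ-< w y x (subst (_≤ x) same-min (lastLow-≤ u x)) x<y ⟩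
  #≥ (suc x) (w ∷ʳ y)        ≡⟨ same-counts (suc x) ⟨
  #≥ (suc x) (u ∷ʳ x)        ≡⟨ Avoiding-∷ʳ⇒#>-Low u x t ⟩
  #≥ (suc x) (Low (u ∷ʳ x))  ∎)
  where
  open ≤-Reasoning
  same-min : lastLow u x ≡ lastLow w y
  same-min = ∷ʳ-injectiveʳ (Low u) (Low w) (trans (sym (Low-∷ʳ u x)) (trans same-Low (Low-∷ʳ w y)))

Avoiding-unique : ∀ k u w → length u ≡ k → Avoiding u → Avoiding w →
  (∀ ℓ → #≥ ℓ u ≡ #≥ ℓ w) → Low u ≡ Low w → u ≡ w
Avoiding-unique k u w |u|≡k tu tw same-counts same-Low with initLast u | initLast w
... | []        | []        = refl
... | []        | w′ ∷ʳ′ y  = ⊥-elim (0≢1+n (trans (same-counts 0) (trans (#≥0≡length (w′ ∷ʳ y)) (length-∷ʳ w′ y))))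
... | u′ ∷ʳ′ x  | []        = ⊥-elim (0≢1+n (trans (sym (same-counts 0)) (trans (#≥0≡length (u′ ∷ʳ x)) (length-∷ʳ u′ x))))
... | u′ ∷ʳ′ x  | w′ ∷ʳ′ y  with k | <-cmp x y
...   | zero   | _            = ⊥-elim (0≢1+n (trans (sym |u|≡k) (length-∷ʳ u′ x)))
...   | suc _  | tri< x<y _ _ = ⊥-elim (Avoiding-∷ʳ-last-≮ u′ x w′ y tu same-counts same-Low x<y)
...   | suc _  | tri> _ _ y<x = ⊥-elim (Avoiding-∷ʳ-last-≮ w′ y u′ x tw (λ ℓ → sym (same-counts ℓ)) (sym same-Low) y<x)
...   | suc k′ | tri≈ _ refl _ = cong (_∷ʳ x) (Avoiding-unique k′ u′ w′ |u′|≡k′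
                          (proj₁ (Avoiding-∷ʳ⁻ u′ x tu)) (proj₁ (Avoiding-∷ʳ⁻ w′ x tw)) same-counts′ same-Low′)
  where
  |u′|≡k′ : length u′ ≡ k′
  |u′|≡k′ = suc-injective (trans (sym (length-∷ʳ u′ x)) |u|≡k)
  same-Low′ : Low u′ ≡ Low w′
  same-Low′ = ∷ʳ-injectiveˡ (Low u′) (Low w′) (trans (sym (Low-∷ʳ u′ x)) (trans same-Low (Low-∷ʳ w′ x)))
  same-counts′ : ∀ ℓ → #≥ ℓ u′ ≡ #≥ ℓ w′
  same-counts′ ℓ = +-cancelʳ-≡ (atLeast ℓ x) (#≥ ℓ u′) (#≥ ℓ w′)
    (trans (sym (tally-∷ʳ (atLeast ℓ) u′ x)) (trans (same-counts ℓ) (tally-∷ʳ (atLeast ℓ) w′ x)))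

-- Constructing an avoiding word from its letter counts and its Low

#≥-∷ʳ-≥ : ∀ ℓ w x → #≥ ℓ w ≤ #≥ ℓ (w ∷ʳ x)
#≥-∷ʳ-≥ ℓ w x = ≤-trans (m≤m+n _ _) (≤-reflexive (sym (tally-∷ʳ (atLeast ℓ) w x)))

#≥-∷ʳ-below : ∀ {ℓ} w {x} → x < ℓ → #≥ ℓ (w ∷ʳ x) ≡ #≥ ℓ w
#≥-∷ʳ-below {ℓ} w {x} x<ℓ =
  trans (tally-∷ʳ (atLeast ℓ) w x) (trans (cong (#≥ ℓ w +_) (atLeast-no x<ℓ)) (+-identityʳ _))

<⇒≤∸1 : ∀ {m n} → m < n → m ≤ n ∸ 1
<⇒≤∸1 (s≤s m≤n) = m≤n

antitone-≤ : ∀ (g : ℕ → ℕ) → (∀ ℓ → g (suc ℓ) ≤ g ℓ) → ∀ {a b} → a ≤ b → g b ≤ g a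
antitone-≤ g step {a} a≤b = go (≤⇒≤′ a≤b)
  where
  go : ∀ {b} → a ≤′ b → g b ≤ g a
  go ≤′-refl     = ≤-refl
  go (≤′-step p) = ≤-trans (step _) (go p)

least-≥ : ∀ {P : ℕ → Set} → (∀ ℓ → Dec (P ℓ)) → ∀ m k → P (k + m) →
  Σ ℕ λ x → m ≤ x × P x × (∀ ℓ → m ≤ ℓ → ℓ < x → ¬ P ℓ)
least-≥ P? m zero    pm = m , ≤-refl , pm , λ ℓ m≤ℓ ℓ<m _ → <⇒≱ ℓ<m m≤ℓ
least-≥ {P} P? m (suc k) p with P? m
... | yes pm = m , ≤-refl , pm , λ ℓ m≤ℓ ℓ<m _ → <⇒≱ ℓ<m m≤ℓ
... | no ¬pm with least-≥ P? (suc m) k (subst P (sym (+-suc k m)) p)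
...   | x , m<x , px , none-below = x , <⇒≤ m<x , px , none-below′
  where
  none-below′ : ∀ ℓ → m ≤ ℓ → ℓ < x → ¬ P ℓ
  none-below′ ℓ m≤ℓ ℓ<x with m≤n⇒m<n∨m≡n m≤ℓ
  ... | inj₁ m<ℓ  = none-below ℓ m<ℓ ℓ<x
  ... | inj₂ refl = ¬pm

Low≡[]⇒≡[] : ∀ w → Low w ≡ [] → w ≡ []
Low≡[]⇒≡[] [] _ = refl

lastLow-≡ : ∀ w {y m x} → Low w ≡ y → NonIncr (y ∷ʳ m) → m ≤ x → x ≡ m ⊎ m ∈ y → lastLow w x ≡ m
lastLow-≡ w {y} {m} {x} Low≡y ni m≤x x≡m⊎m∈y with initLast y
lastLow-≡ w Low≡[] ni m≤x x≡m⊎m∈[] | [] rewrite Low≡[]⇒≡[] w Low≡[] with x≡m⊎m∈[]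
... | inj₁ x≡m = x≡m
lastLow-≡ w {m = m} {x} Low≡y ni m≤x x≡m⊎m∈y | y′ ∷ʳ′ m′ =
  trans (lastLow-∷ʳ w x y′ Low≡y) (min≡m x≡m⊎m∈y)
  where
  m≤m′ : m ≤ m′
  m≤m′ = All.lookup (proj₂ (nonIncr-∷ʳ⁻ (y′ ∷ʳ m′) ni)) (∈-++⁺ʳ y′ (here refl))
  m′≤y : All (m′ ≤_) (y′ ∷ʳ m′)
  m′≤y = ++⁺ (proj₂ (nonIncr-∷ʳ⁻ y′ (proj₁ (nonIncr-∷ʳ⁻ (y′ ∷ʳ m′) ni)))) (≤-refl ∷ [])
  min≡m : x ≡ m ⊎ m ∈ y′ ∷ʳ m′ → m′ ⊓ x ≡ m
  min≡m (inj₁ refl) = m≥n⇒m⊓n≡n m≤m′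
  min≡m (inj₂ m∈y)  = trans (cong (_⊓ x) (≤-antisym (All.lookup m′≤y m∈y) m≤m′)) (m≤n⇒m⊓n≡m m≤x)

-- g ℓ is to become the number of letters ≥ ℓ of a word w with Low w ≡ y.
record Compatible (y : List ℕ) (g : ℕ → ℕ) : Set where
  field
    nonIncr   : NonIncr y
    dominates : ∀ ℓ → #≥ ℓ y ≤ g ℓ
    total     : g 0 ≡ length y
    antitone  : ∀ ℓ → g (suc ℓ) ≤ g ℓ
    bound     : ℕ
    vanishes  : g bound ≡ 0
    support   : All (λ r → g (suc r) < g r) y

-- The last letter x of the word realising (y′ ∷ʳ m, g) is the least ℓ ≥ m at which the
-- letters above ℓ are already accounted for by y′ ∷ʳ m.
module LastLetter {y′ : List ℕ} {m : ℕ} {g : ℕ → ℕ} (C : Compatible (y′ ∷ʳ m) g) where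
  open Compatible C

  m≤y′ : All (m ≤_) y′
  m≤y′ = proj₂ (nonIncr-∷ʳ⁻ y′ nonIncr)

  g-anti : ∀ {a b} → a ≤ b → g b ≤ g a
  g-anti = antitone-≤ g antitone

  g≡length : ∀ {ℓ} → ℓ ≤ m → g ℓ ≡ suc (length y′)
  g≡length {ℓ} ℓ≤m = ≤-antisym
    (≤-trans (g-anti z≤n) (≤-reflexive (trans total (length-∷ʳ y′ m))))
    (begin
      suc (length y′)     ≡⟨ length-∷ʳ y′ m ⟨
      length (y′ ∷ʳ m)    ≡⟨ tally-≡length (All.map (λ m≤a → atLeast-yes (≤-trans ℓ≤m m≤a)) (++⁺ m≤y′ (≤-refl ∷ []))) ⟨
      #≥ ℓ (y′ ∷ʳ m)      ≤⟨ dominates ℓ ⟩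
      g ℓ                 ∎)
    where open ≤-Reasoning

  Settled : ℕ → Set
  Settled ℓ = g (suc ℓ) ≡ #≥ (suc ℓ) (y′ ∷ʳ m)

  settled-far : Settled (bound + m)
  settled-far = trans g≡0 (sym (n≤0⇒n≡0 (≤-trans (dominates _) (≤-reflexive g≡0))))
    where
    g≡0 : g (suc (bound + m)) ≡ 0
    g≡0 = n≤0⇒n≡0 (≤-trans (g-anti (m≤n⇒m≤1+n (m≤m+n bound m))) (≤-reflexive vanishes))

  first-settled : Σ ℕ λ x → m ≤ x × Settled x × (∀ ℓ → m ≤ ℓ → ℓ < x → ¬ Settled ℓ)
  first-settled = least-≥ (λ ℓ → g (suc ℓ) ≟ #≥ (suc ℓ) (y′ ∷ʳ m)) m bound settled-far

  x : ℕ
  x = proj₁ first-settled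

  m≤x : m ≤ x
  m≤x = proj₁ (proj₂ first-settled)

  settled-x : Settled x
  settled-x = proj₁ (proj₂ (proj₂ first-settled))

  unsettled : ∀ ℓ → m ≤ ℓ → ℓ < x → #≥ (suc ℓ) (y′ ∷ʳ m) < g (suc ℓ)
  unsettled ℓ m≤ℓ ℓ<x = ≤∧≢⇒< (dominates (suc ℓ)) (λ e → proj₂ (proj₂ (proj₂ first-settled)) ℓ m≤ℓ ℓ<x (sym e))

  y′-below : ∀ ℓ → ℓ ≤ x → #≥ ℓ y′ < g ℓ
  y′-below ℓ ℓ≤x with ℓ ≤? m
  ... | yes ℓ≤m = subst (#≥ ℓ y′ <_) (sym (g≡length ℓ≤m)) (s≤s (#≥≤length ℓ y′))
  ... | no ℓ≰m  = strictly-above (≰⇒> ℓ≰m) ℓ≤x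
    where
    strictly-above : ∀ {ℓ} → m < ℓ → ℓ ≤ x → #≥ ℓ y′ < g ℓ
    strictly-above {suc ℓ} (s≤s m≤ℓ) ℓ<x = ≤-<-trans (#≥-∷ʳ-≥ (suc ℓ) y′ m) (unsettled ℓ m≤ℓ ℓ<x)

  x-occurs : g (suc x) < g x
  x-occurs = begin-strict
    g (suc x)               ≡⟨ settled-x ⟩
    #≥ (suc x) (y′ ∷ʳ m)    ≡⟨ #≥-∷ʳ-below y′ (s≤s m≤x) ⟩
    #≥ (suc x) y′           ≤⟨ #≥-suc-≤ x y′ ⟩
    #≥ x y′                 <⟨ y′-below x ≤-refl ⟩
    g x                     ∎
    where open ≤-Reasoning

  g′ : ℕ → ℕ
  g′ ℓ = g ℓ ∸ atLeast ℓ x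

  g′≡g∸1 : ∀ {ℓ} → ℓ ≤ x → g′ ℓ ≡ g ℓ ∸ 1
  g′≡g∸1 ℓ≤x = cong (g _ ∸_) (atLeast-yes ℓ≤x)

  g′≡g : ∀ {ℓ} → x < ℓ → g′ ℓ ≡ g ℓ
  g′≡g x<ℓ = cong (g _ ∸_) (atLeast-no x<ℓ)

  atLeast-x≤g : ∀ ℓ → atLeast ℓ x ≤ g ℓ
  atLeast-x≤g ℓ with ℓ ≤? x
  ... | yes ℓ≤x = ≤-trans (≤-reflexive (atLeast-yes ℓ≤x)) (≤-trans (≤-trans (s≤s z≤n) x-occurs) (g-anti ℓ≤x))
  ... | no ℓ≰x  = ≤-trans (≤-reflexive (atLeast-no (≰⇒> ℓ≰x))) z≤n

  g′-dominates : ∀ ℓ → #≥ ℓ y′ ≤ g′ ℓ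
  g′-dominates ℓ with ℓ ≤? x
  ... | yes ℓ≤x = subst (#≥ ℓ y′ ≤_) (sym (g′≡g∸1 ℓ≤x)) (<⇒≤∸1 (y′-below ℓ ℓ≤x))
  ... | no ℓ≰x  = subst (#≥ ℓ y′ ≤_) (sym (g′≡g (≰⇒> ℓ≰x))) (≤-trans (#≥-∷ʳ-≥ ℓ y′ m) (dominates ℓ))

  g′-antitone : ∀ ℓ → g′ (suc ℓ) ≤ g′ ℓ
  g′-antitone ℓ with <-cmp ℓ x
  ... | tri< ℓ<x _ _ rewrite g′≡g∸1 ℓ<x | g′≡g∸1 (<⇒≤ ℓ<x) = ∸-monoˡ-≤ 1 (antitone ℓ)
  ... | tri≈ _ refl _ rewrite g′≡g {suc ℓ} ≤-refl | g′≡g∸1 {ℓ} ≤-refl = <⇒≤∸1 x-occurs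
  ... | tri> _ _ x<ℓ rewrite g′≡g (m<n⇒m<1+n x<ℓ) | g′≡g x<ℓ = antitone ℓ

  g′-support : ∀ {r} → r ∈ y′ → g′ (suc r) < g′ r
  g′-support {r} r∈y′ with <-cmp r x
  ... | tri< r<x _ _ rewrite g′≡g∸1 r<x | g′≡g∸1 (<⇒≤ r<x) =
    ∸-monoˡ-< (All.lookup support (∈-++⁺ˡ r∈y′)) (≤-trans (s≤s z≤n) (unsettled r (All.lookup m≤y′ r∈y′) r<x))
  ... | tri≈ _ refl _ rewrite g′≡g {suc r} ≤-refl | g′≡g∸1 {r} ≤-refl = begin-strict
    g (suc r)               ≡⟨ settled-x ⟩
    #≥ (suc r) (y′ ∷ʳ m)    ≡⟨ #≥-∷ʳ-below y′ (s≤s m≤x) ⟩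
    #≥ (suc r) y′           <⟨ ∈⇒#>-<-#≥ r∈y′ ⟩
    #≥ r y′                 ≤⟨ <⇒≤∸1 (y′-below r ≤-refl) ⟩
    g r ∸ 1                 ∎
    where open ≤-Reasoning
  ... | tri> _ _ x<r rewrite g′≡g (m<n⇒m<1+n x<r) | g′≡g x<r = All.lookup support (∈-++⁺ˡ r∈y′)

  compatible : Compatible y′ g′
  compatible = record
    { nonIncr   = proj₁ (nonIncr-∷ʳ⁻ y′ nonIncr)
    ; dominates = g′-dominates
    ; total     = cong (_∸ 1) (trans total (length-∷ʳ y′ m))
    ; antitone  = g′-antitone
    ; bound     = bound
    ; vanishes  = trans (cong (_∸ atLeast bound x) vanishes) (0∸n≡0 (atLeast bound x))
    ; support   = All.tabulate g′-support
    }

  settled-if-absent : ¬ m ∈ y′ → Settled m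
  settled-if-absent m∉y′ = ≤-antisym
    (≤-trans (≤-pred (≤-trans (All.lookup support (∈-++⁺ʳ y′ (here refl))) (≤-reflexive (g≡length ≤-refl))))
             (≤-reflexive (sym #>m≡length)))
    (dominates (suc m))
    where
    #>m≡length : #≥ (suc m) (y′ ∷ʳ m) ≡ length y′
    #>m≡length = trans (#≥-∷ʳ-below y′ ≤-refl)
      (tally-≡length (All.map atLeast-yes (All.zipWith (λ (m≤a , m≢a) → ≤∧≢⇒< m≤a m≢a) (m≤y′ , ¬Any⇒All¬ y′ m∉y′))))

  x≡m⊎m∈y′ : x ≡ m ⊎ m ∈ y′
  x≡m⊎m∈y′ with m ∈? y′
  ... | yes m∈y′ = inj₂ m∈y′
  ... | no m∉y′ with m <? x
  ...   | yes m<x = ⊥-elim (proj₂ (proj₂ (proj₂ first-settled)) m ≤-refl m<x (settled-if-absent m∉y′))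
  ...   | no m≮x  = inj₁ (≤-antisym (≮⇒≥ m≮x) m≤x)

  extend : ∀ {w′} → Avoiding w′ → Low w′ ≡ y′ → (∀ ℓ → #≥ ℓ w′ ≡ g′ ℓ) →
    Avoiding (w′ ∷ʳ x) × Low (w′ ∷ʳ x) ≡ y′ ∷ʳ m × (∀ ℓ → #≥ ℓ (w′ ∷ʳ x) ≡ g ℓ)
  extend {w′} t Low≡y′ counts = avoiding , low , counts′
    where
    w′-split : #≥ (suc x) w′ ≡ #≥ (suc x) (Low w′)
    w′-split = begin
      #≥ (suc x) w′           ≡⟨ counts (suc x) ⟩
      g′ (suc x)              ≡⟨ g′≡g ≤-refl ⟩
      g (suc x)               ≡⟨ settled-x ⟩
      #≥ (suc x) (y′ ∷ʳ m)    ≡⟨ #≥-∷ʳ-below y′ (s≤s m≤x) ⟩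
      #≥ (suc x) y′           ≡⟨ cong (#≥ (suc x)) Low≡y′ ⟨
      #≥ (suc x) (Low w′)     ∎
      where open ≡-Reasoning
    avoiding : Avoiding (w′ ∷ʳ x)
    avoiding = Avoiding-∷ʳ⁺ w′ x t (AboveThenAtMost⇒AboveFirst w′ (#>-Low⇒AboveThenAtMost w′ w′-split))
    low : Low (w′ ∷ʳ x) ≡ y′ ∷ʳ m
    low = trans (Low-∷ʳ w′ x) (cong₂ _∷ʳ_ Low≡y′ (lastLow-≡ w′ Low≡y′ nonIncr m≤x x≡m⊎m∈y′))
    counts′ : ∀ ℓ → #≥ ℓ (w′ ∷ʳ x) ≡ g ℓ
    counts′ ℓ = trans (tally-∷ʳ (atLeast ℓ) w′ x) (trans (cong (_+ atLeast ℓ x) (counts ℓ)) (m∸n+n≡m (atLeast-x≤g ℓ)))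

realise : ∀ k y g → length y ≡ k → Compatible y g →
  Σ (List ℕ) λ w → Avoiding w × Low w ≡ y × (∀ ℓ → #≥ ℓ w ≡ g ℓ)
realise k y g |y|≡k C with initLast y
... | [] = [] , tt , refl , λ ℓ → sym (n≤0⇒n≡0 (≤-trans (antitone-≤ g antitone z≤n) (≤-reflexive total)))
  where open Compatible C
... | y′ ∷ʳ′ m with k
...   | zero   = ⊥-elim (0≢1+n (trans (sym |y|≡k) (length-∷ʳ y′ m)))
...   | suc k′ with realise k′ y′ (LastLetter.g′ C) (suc-injective (trans (sym (length-∷ʳ y′ m)) |y|≡k)) (LastLetter.compatible C)
...     | w′ , t , Low≡y′ , counts = w′ ∷ʳ LastLetter.x C , LastLetter.extend C t Low≡y′ counts

-- The vertical encoding and its inverse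

cumulative : (k : ℕ) → List ℕ → Vec ℕ k
cumulative zero    _ = []
cumulative (suc k) z = #≤ (suc k) z ∷ cumulative k z

cumulative-cong : ∀ k {a b} → (∀ {j} → j ≤ k → #≤ j a ≡ #≤ j b) → cumulative k a ≡ cumulative k b
cumulative-cong zero    _ = refl
cumulative-cong (suc k) h = cong₂ _∷_ (h ≤-refl) (cumulative-cong k (λ j≤k → h (m≤n⇒m≤1+n j≤k)))

cumulative-replicate-++ : ∀ k c w → cumulative k (replicate c (suc k) ++ w) ≡ cumulative k w
cumulative-replicate-++ k c w = cumulative-cong k (λ j≤k → #≤-replicate-++ c w (s≤s j≤k))

#≤-replicate-++-≡ : ∀ {j a} c w → a ≤ j → All (_≤ j) w → #≤ j (replicate c a ++ w) ≡ c + length w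
#≤-replicate-++-≡ {a = a} c w a≤j w≤j = begin
  #≤ _ (replicate c a ++ w)         ≡⟨ #≤≡length (++⁺ (replicate⁺ c a≤j) w≤j) ⟩
  length (replicate c a ++ w)       ≡⟨ length-++ (replicate c a) ⟩
  length (replicate c a) + length w ≡⟨ cong (_+ length w) (length-replicate c) ⟩
  c + length w                      ∎
  where open ≡-Reasoning

Letter-weaken : ∀ {k a} → Letter k a → Letter (suc k) a
Letter-weaken (1≤a , a≤k) = 1≤a , m≤n⇒m≤1+n a≤k

Letter-0 : ∀ {a} → ¬ Letter 0 a
Letter-0 (1≤a , a≤0) = <⇒≱ 1≤a a≤0

first-cumulative : ∀ k z → All (Letter k) z → first (cumulative k z) ≡ length z
first-cumulative zero    []      _         = refl
first-cumulative zero    (a ∷ z) (la ∷ _)  = ⊥-elim (Letter-0 la)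
first-cumulative (suc k) z       z∈[1,k]  = #≤≡length (All.map proj₂ z∈[1,k])

cumulative-nonIncr : ∀ k z → NonIncrSeq (cumulative k z)
cumulative-nonIncr zero          _ = ni-[]
cumulative-nonIncr (suc zero)    _ = ni-[x]
cumulative-nonIncr (suc (suc k)) z = ni-∷ (#≤-suc-≥ (suc k) z) (cumulative-nonIncr (suc k) z)

cumulative-positive : ∀ k z → 1 ∈ z → All (1 ≤_) (toList (cumulative k z))
cumulative-positive zero    _ _   = []
cumulative-positive (suc k) z 1∈z = ∈⇒1≤#≤ 1∈z (s≤s z≤n) ∷ cumulative-positive k z 1∈z

nonIncrSeq-uncons : ∀ {k x} {xs : Vec ℕ k} → NonIncrSeq (x ∷ xs) → first xs ≤ x × NonIncrSeq xs
nonIncrSeq-uncons {xs = []}    _           = z≤n , ni-[]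
nonIncrSeq-uncons {xs = _ ∷ _} (ni-∷ p ni) = p , ni

W-Letter : ∀ {k} (u : Vec ℕ k) → All (Letter k) (W u)
W-Letter []                = []
W-Letter {suc k} (x ∷ xs) = ++⁺ (replicate⁺ (x ∸ first xs) (s≤s z≤n , ≤-refl)) (All.map Letter-weaken (W-Letter xs))

W-≤ : ∀ {k} (u : Vec ℕ k) → All (_≤ k) (W u)
W-≤ u = All.map proj₂ (W-Letter u)

W-nonIncr : ∀ {k} (u : Vec ℕ k) → NonIncr (W u)
W-nonIncr []                = ni-[]
W-nonIncr {suc k} (x ∷ xs) = nonIncr-replicate-++ (x ∸ first xs) (W-nonIncr xs) (All.map m≤n⇒m≤1+n (W-≤ xs))

length-W : ∀ {k} (u : Vec ℕ k) → NonIncrSeq u → length (W u) ≡ first u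
length-W []                _  = refl
length-W {suc k} (x ∷ xs) ni = begin
  length (replicate (x ∸ first xs) (suc k) ++ W xs)       ≡⟨ length-++ (replicate (x ∸ first xs) (suc k)) ⟩
  length (replicate (x ∸ first xs) (suc k)) + length (W xs) ≡⟨ cong₂ _+_ (length-replicate (x ∸ first xs)) (length-W xs (proj₂ (nonIncrSeq-uncons ni))) ⟩
  x ∸ first xs + first xs                                  ≡⟨ m∸n+n≡m (proj₁ (nonIncrSeq-uncons ni)) ⟩
  x                                                        ∎
  where open ≡-Reasoning

cumulative-W : ∀ {k} (u : Vec ℕ k) → NonIncrSeq u → cumulative k (W u) ≡ u
cumulative-W []                _  = refl
cumulative-W {suc k} (x ∷ xs) ni = cong₂ _∷_ head (trans (cumulative-replicate-++ k c (W xs)) (cumulative-W xs ni′))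
  where
  c : ℕ
  c = x ∸ first xs
  ni′ : NonIncrSeq xs
  ni′ = proj₂ (nonIncrSeq-uncons ni)
  head : #≤ (suc k) (replicate c (suc k) ++ W xs) ≡ x
  head = trans (#≤-replicate-++-≡ c (W xs) ≤-refl (All.map m≤n⇒m≤1+n (W-≤ xs)))
               (trans (cong (c +_) (length-W xs ni′)) (m∸n+n≡m (proj₁ (nonIncrSeq-uncons ni))))

split-top : ∀ k z → NonIncr z → All (Letter (suc k)) z →
  Σ ℕ λ c → Σ (List ℕ) λ z′ → z ≡ replicate c (suc k) ++ z′ × NonIncr z′ × All (Letter k) z′
split-top k []      _  _                    = 0 , [] , refl , ni-[] , []
split-top k (a ∷ z) ni (la@(1≤a , a≤1+k) ∷ lz) with a ≟ suc k
... | yes refl with split-top k z (nonIncr-tail ni) lz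
...   | c , z′ , refl , ni′ , lz′ = suc c , z′ , refl , ni′ , lz′
split-top k (a ∷ z) ni (la@(1≤a , a≤1+k) ∷ lz) | no a≢1+k =
  0 , a ∷ z , refl , ni , (1≤a , a≤k) ∷ All.zipWith (λ ((1≤b , _) , b≤a) → 1≤b , ≤-trans b≤a a≤k) (lz , nonIncr-head-max ni)
  where
  a≤k : a ≤ k
  a≤k = ≤-pred (≤∧≢⇒< a≤1+k a≢1+k)

W-cumulative : ∀ k z → NonIncr z → All (Letter k) z → W (cumulative k z) ≡ z
W-cumulative zero    []      _  _        = refl
W-cumulative zero    (a ∷ z) _  (la ∷ _) = ⊥-elim (Letter-0 la)
W-cumulative (suc k) z       ni lz with split-top k z ni lz
... | c , z′ , refl , ni′ , lz′ = cong₂ (λ d t → replicate d (suc k) ++ t) count (trans (cong W same-tail) (W-cumulative k z′ ni′ lz′))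
  where
  same-tail : cumulative k (replicate c (suc k) ++ z′) ≡ cumulative k z′
  same-tail = cumulative-replicate-++ k c z′
  count : #≤ (suc k) (replicate c (suc k) ++ z′) ∸ first (cumulative k (replicate c (suc k) ++ z′)) ≡ c
  count = begin
    #≤ (suc k) (replicate c (suc k) ++ z′) ∸ first (cumulative k (replicate c (suc k) ++ z′))
      ≡⟨ cong₂ _∸_ (#≤-replicate-++-≡ c z′ ≤-refl (All.map (m≤n⇒m≤1+n ∘ proj₂) lz′))
                   (trans (cong first same-tail) (first-cumulative k z′ lz′)) ⟩
    c + length z′ ∸ length z′
      ≡⟨ m+n∸n≡m c (length z′) ⟩
    c ∎
    where open ≡-Reasoning

1∈W : ∀ {k} (u : Vec ℕ (suc k)) → All (1 ≤_) (toList u) → 1 ∈ W u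
1∈W (suc x ∷ [])                 _        = here refl
1∈W {suc k} (x ∷ x′ ∷ xs) (_ ∷ 1≤u) = ∈-++⁺ʳ (replicate (x ∸ x′) (suc (suc k))) (1∈W (x′ ∷ xs) 1≤u)

cumulative-⊴ : ∀ k {a b} → (∀ j → #≤ j a ≤ #≤ j b) → (∀ j → #≤ j b < #≤ (suc j) b → #≤ j a < #≤ (suc j) a) →
  cumulative k a ⊴ cumulative k b
cumulative-⊴ zero          _ _ = tt
cumulative-⊴ (suc zero)    h _ = h 1
cumulative-⊴ (suc (suc k)) h d = h (suc (suc k)) , d (suc k) , cumulative-⊴ (suc k) h d

⊴⇒#≤-≤ : ∀ k {a b} → cumulative k a ⊴ cumulative k b → ∀ j → suc j ≤ k → #≤ (suc j) a ≤ #≤ (suc j) b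
⊴⇒#≤-≤ (suc zero)    le              zero    _           = le
⊴⇒#≤-≤ (suc zero)    _               (suc j) (s≤s ())
⊴⇒#≤-≤ (suc (suc k)) {a} {b} (le , _ , rest) j j<k = [
    (λ j≡k → subst (λ t → #≤ (suc t) a ≤ #≤ (suc t) b) (sym j≡k) le) ,
    (λ j≢k → ⊴⇒#≤-≤ (suc k) rest j (≤-pred (≤∧≢⇒< j<k (j≢k ∘ suc-injective)))) ]′ (toSum (j ≟ suc k))

⊴⇒#≤-jump : ∀ k {a b} → cumulative k a ⊴ cumulative k b → ∀ j → suc (suc j) ≤ k →
  #≤ (suc j) b < #≤ (suc (suc j)) b → #≤ (suc j) a < #≤ (suc (suc j)) a
⊴⇒#≤-jump (suc zero)    _                 j (s≤s ())
⊴⇒#≤-jump (suc (suc k)) {a} {b} (_ , jump , rest) j j<k = [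
    (λ j≡k → subst (λ t → #≤ (suc t) b < #≤ (suc (suc t)) b → #≤ (suc t) a < #≤ (suc (suc t)) a) (sym j≡k) jump) ,
    (λ j≢k → ⊴⇒#≤-jump (suc k) rest j (≤-pred (≤∧≢⇒< j<k (j≢k ∘ suc-injective ∘ suc-injective)))) ]′ (toSum (j ≟ k))

InW-↭ : ∀ {n u w} → u ↭ w → InW n u → InW n w
InW-↭ u↭w (u∈[1,n] , 1∈u) = All-resp-↭ u↭w u∈[1,n] , ∈-resp-↭ u↭w 1∈u

Low-InW : ∀ {n} w → InW n w → InW n (Low w)
Low-InW w (w∈[1,n] , 1∈w) = Low-All w w∈[1,n] , ∈-Low (All.map proj₁ w∈[1,n]) 1∈w

W-InW : ∀ {k} (u : Vec ℕ (suc k)) → Positive u → InW (suc k) (W u)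
W-InW u (_ , 1≤u) = W-Letter u , 1∈W u 1≤u

NInc-⊴-Low : ∀ n w → cumulative n (NInc w) ⊴ cumulative n (Low w)
NInc-⊴-Low n w = cumulative-⊴ n fewer-small jumps
  where
  fewer-small : ∀ j → #≤ j (NInc w) ≤ #≤ j (Low w)
  fewer-small j = ≤-trans (≤-reflexive (tally-↭ _ (NInc-↭ w))) (#≤-Low-≥ j w)
  jumps : ∀ j → #≤ j (Low w) < #≤ (suc j) (Low w) → #≤ j (NInc w) < #≤ (suc j) (NInc w)
  jumps j jump = ∈⇒#≤-<-#≤suc (∈-resp-↭ (↭-sym (NInc-↭ w)) (∈-Low⁻ w (#≤-<-#≤suc⇒∈ (Low w) jump)))

#≤-≤⇒#>-≥ : ∀ j {y z} → #≤ j z ≤ #≤ j y → length z ≡ length y → #≥ (suc j) y ≤ #≥ (suc j) z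
#≤-≤⇒#>-≥ j {y} {z} fewer-small same-length = +-cancelˡ-≤ (#≤ j z) _ _ (begin
  #≤ j z + #≥ (suc j) y  ≤⟨ +-monoˡ-≤ _ fewer-small ⟩
  #≤ j y + #≥ (suc j) y  ≡⟨ #≤+#>≡length j y ⟩
  length y               ≡⟨ same-length ⟨
  length z               ≡⟨ #≤+#>≡length j z ⟨
  #≤ j z + #≥ (suc j) z  ∎)
  where open ≤-Reasoning

Φ-interval : ∀ n w → InW n w →
  Σ (Vec ℕ n) λ u → Σ (Vec ℕ n) λ v →
    Positive u × Positive v × W u ≡ NInc w × W v ≡ Low w × first u ≡ length w × first v ≡ length w × u ⊴ v
Φ-interval n w w∈𝒲 =
  cumulative n z , cumulative n y ,
  (cumulative-nonIncr n z , cumulative-positive n z (proj₂ z∈𝒲)) ,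
  (cumulative-nonIncr n y , cumulative-positive n y (proj₂ y∈𝒲)) ,
  W-cumulative n z (NInc-nonIncr w) (proj₁ z∈𝒲) , W-cumulative n y (Low-nonIncr w) (proj₁ y∈𝒲) ,
  trans (first-cumulative n z (proj₁ z∈𝒲)) (↭-length (NInc-↭ w)) ,
  trans (first-cumulative n y (proj₁ y∈𝒲)) (length-Low w) ,
  NInc-⊴-Low n w
  where
  z y : List ℕ
  z = NInc w
  y = Low w
  z∈𝒲 : InW n z
  z∈𝒲 = InW-↭ (↭-sym (NInc-↭ w)) w∈𝒲
  y∈𝒲 : InW n y
  y∈𝒲 = Low-InW w w∈𝒲

module Interval {k : ℕ} (u v : Vec ℕ (suc k)) (pu : Positive u) (pv : Positive v)
                (u⊴v : u ⊴ v) (same-first : first u ≡ first v) where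

  same-length : length (W u) ≡ length (W v)
  same-length = trans (length-W u (proj₁ pu)) (trans same-first (sym (length-W v (proj₁ pv))))

  encoded-⊴ : cumulative (suc k) (W u) ⊴ cumulative (suc k) (W v)
  encoded-⊴ = subst₂ _⊴_ (sym (cumulative-W u (proj₁ pu))) (sym (cumulative-W v (proj₁ pv))) u⊴v

  fewer-small : ∀ j → #≤ j (W u) ≤ #≤ j (W v)
  fewer-small zero = ≤-reflexive (trans (#≤≡0 (All.map proj₁ (W-Letter u))) (sym (#≤≡0 (All.map proj₁ (W-Letter v)))))
  fewer-small (suc j) with suc j ≤? suc k
  ... | yes j<n = ⊴⇒#≤-≤ (suc k) encoded-⊴ j j<n
  ... | no j≮n  = ≤-reflexive (trans (#≤≡length (all≤ u)) (trans same-length (sym (#≤≡length (all≤ v)))))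
    where
    all≤ : (t : Vec ℕ (suc k)) → All (_≤ suc j) (W t)
    all≤ t = All.map (λ a≤n → ≤-trans a≤n (<⇒≤ (≰⇒> j≮n))) (W-≤ t)

  letters-shared : ∀ {r} → r ∈ W v → r ∈ W u
  letters-shared r∈Wv with All.lookup (W-Letter v) r∈Wv
  ... | s≤s {n = zero} z≤n , _ = 1∈W u (proj₂ pu)
  ... | s≤s {n = suc j} z≤n , r≤n =
    #≤-<-#≤suc⇒∈ (W u) (⊴⇒#≤-jump (suc k) encoded-⊴ j r≤n (∈⇒#≤-<-#≤suc r∈Wv))

  compatible : Compatible (W v) (λ ℓ → #≥ ℓ (W u))
  compatible = record
    { nonIncr   = W-nonIncr v
    ; dominates = λ { zero → ≤-reflexive (trans (#≥0≡length (W v)) (trans (sym same-length) (sym (#≥0≡length (W u)))))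
                    ; (suc j) → #≤-≤⇒#>-≥ j {W v} {W u} (fewer-small j) same-length }
    ; total     = trans (#≥0≡length (W u)) same-length
    ; antitone  = λ ℓ → #≥-suc-≤ ℓ (W u)
    ; bound     = suc (suc k)
    ; vanishes  = #≥≡0 (All.map s≤s (W-≤ u))
    ; support   = All.tabulate (λ r∈Wv → ∈⇒#>-<-#≥ (letters-shared r∈Wv))
    }

  avoiding-preimage : ∃! _≡_ (λ w → InW (suc k) w × Avoids-aba-acb w × W u ≡ NInc w × W v ≡ Low w)
  avoiding-preimage with realise _ (W v) _ refl compatible
  ... | w , t , Low≡Wv , counts = w , (w∈𝒲 , Avoiding⇒Avoids w t , sym NInc≡Wu , sym Low≡Wv) , unique
    where
    NInc≡Wu : NInc w ≡ W u
    NInc≡Wu = nonIncr-≡ (NInc-nonIncr w) (W-nonIncr u) (λ ℓ → trans (tally-↭ _ (NInc-↭ w)) (counts ℓ))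
    w∈𝒲 : InW (suc k) w
    w∈𝒲 = InW-↭ (NInc-↭ w) (subst (InW (suc k)) (sym NInc≡Wu) (W-InW u pu))
    unique : ∀ {w′} → InW (suc k) w′ × Avoids-aba-acb w′ × W u ≡ NInc w′ × W v ≡ Low w′ → w ≡ w′
    unique {w′} (_ , av , Wu≡NInc , Wv≡Low) = Avoiding-unique _ w w′ refl t (Avoids⇒Avoiding w′ av)
      (λ ℓ → trans (counts ℓ) (trans (cong (#≥ ℓ) Wu≡NInc) (tally-↭ _ (NInc-↭ w′))))
      (trans Low≡Wv Wv≡Low)

proposition3p4 : (n : ℕ) → 1 ≤ n →
    ((w : List ℕ) → InW n w →
        NonIncr (NInc w) × NonIncr (Low w)
      × length (NInc w) ≡ length (Low w)
      × InW n (NInc w) × InW n (Low w)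
      × Σ (Vec ℕ n) (λ u → Σ (Vec ℕ n) (λ v →
            Positive u × Positive v
          × W u ≡ NInc w × W v ≡ Low w
          × first u ≡ length w × first v ≡ length w
          × u ⊴ v)))
    × ((u v : Vec ℕ n) → Positive u → Positive v → u ⊴ v → first u ≡ first v →
        ∃! _≡_ (λ w → InW n w × Avoids-aba-acb w × W u ≡ NInc w × W v ≡ Low w))
proposition3p4 zero    ()
proposition3p4 (suc k) _ =
  (λ w w∈𝒲 → NInc-nonIncr w , Low-nonIncr w , trans (↭-length (NInc-↭ w)) (sym (length-Low w)) ,
             InW-↭ (↭-sym (NInc-↭ w)) w∈𝒲 , Low-InW w w∈𝒲 , Φ-interval (suc k) w w∈𝒲) ,
  Interval.avoiding-preimage
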